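{- Let $w,v\in\Sigma^\ast$ with $\mathrm{alph}(w)=\mathrm{alph}(v)$ and let $a,b\in\mathrm{alph}(w)$ with $\{a,b\}\in E(G(w,v))$. Then there exist $1$-uniform words $u_w,u_v\in\Sigma^\ast$ such that $E(G(wu_w,vu_v))=E(G(w,v))\setminus\{\{a,b\}\}$.
   Context: $\Sigma$ is a finite alphabet. For a word $w$, $\mathrm{alph}(w)$ is the set of letters occurring in $w$ and $|w|_c$ the number of occurrences of the letter $c$; a word $u$ is $1$-uniform if $|u|_c=1$ for every $c\in\mathrm{alph}(u)$. For letters $a,b$, $\pi_{a,b}$ is the monoid morphism on $\Sigma^\ast$ with $a\mapsto a$, $b\mapsto b$ and all other letters mapped to the empty word. For words $w,v$ with $\mathrm{alph}(w)=\mathrm{alph}(v)=A$, $G(w,v)$ is the undirected simple graph on vertex set $A$ in which distinct $a,b$ are adjacent iff $\pi_{a,b}(w)=\pi_{a,b}(v)$; $E(\cdot)$ denotes the edge set. -}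

module Defs where

open import Data.Nat using (ℕ)
open import Data.Fin using (Fin; _≟_)
open import Data.List using (List; filter; length; _++_)
open import Data.List.Membership.Propositional using (_∈_)
open import Data.Product using (_×_)
open import Data.Sum using (_⊎_)
open import Relation.Nullary using (¬_)
open import Relation.Nullary.Decidable using (_⊎-dec_)
open import Relation.Binary.PropositionalEquality using (_≡_; _≢_)
open import Function.Bundles using (_⇔_)

Word : ℕ → Set
Word n = List (Fin n)

SameAlph : ∀ {n} → Word n → Word n → Set
SameAlph w v = ∀ c → (c ∈ w) ⇔ (c ∈ v)

occ : ∀ {n} → Fin n → Word n → ℕ
occ c w = length (filter (_≟ c) w)

OneUniform : ∀ {n} → Word n → Set
OneUniform u = ∀ c → c ∈ u → occ c u ≡ 1

proj : ∀ {n} → Fin n → Fin n → Word n → Word n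
proj a b w = filter (λ x → (x ≟ a) ⊎-dec (x ≟ b)) w

Edge : ∀ {n} → Word n → Word n → Fin n → Fin n → Set
Edge w v c d = (c ≢ d) × (c ∈ w) × (d ∈ w) × (proj c d w ≡ proj c d v)

SamePair : ∀ {n} → Fin n → Fin n → Fin n → Fin n → Set
SamePair c d a b = ((c ≡ a) × (d ≡ b)) ⊎ ((c ≡ b) × (d ≡ a))

{-# OPTIONS --safe #-}
-- Take u_w = ab and u_v = ba.  A projection onto a pair containing at most one
-- of a, b maps ab and ba to the same word, so it sees the same suffix on both
-- sides and the old edge relation is kept; the projection onto {a, b} itself
-- ends in b on one side and in a on the other, which destroys that edge.
module Submission where

open import Defs
open import Data.Nat using (ℕ)
open import Data.Fin using (Fin; _≟_)
open import Data.List using (List; []; _∷_; [_]; _++_; length)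
open import Data.List.Properties
  using (filter-accept; filter-reject; filter-all; filter-++; ++-cancelʳ; ++-identityʳ; ∷ʳ-injectiveʳ; ∷ʳ-++)
open import Data.List.Membership.Propositional using (_∈_)
open import Data.List.Membership.Propositional.Properties using (∈-++⁻; ∈-++⁺ˡ)
open import Data.List.Relation.Unary.All as All using (All; []; _∷_)
open import Data.List.Relation.Unary.Any using (here; there)
open import Data.Product using (Σ; _×_; _,_)
open import Data.Sum using (_⊎_; inj₁; inj₂; [_,_]′)
open import Data.Empty using (⊥-elim)
open import Function using (id; _∘_)
open import Relation.Nullary using (¬_; yes; no)
open import Relation.Nullary.Decidable using (_⊎-dec_)
open import Relation.Unary using (Decidable)
open import Relation.Binary.PropositionalEquality using (_≡_; _≢_; refl; sym; trans; cong; cong₂; module ≡-Reasoning)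
open import Function.Bundles using (_⇔_; mk⇔; Equivalence)

++-∷-∷-injective : ∀ {A : Set} {x y : A} (xs ys : List A) →
                   xs ++ x ∷ y ∷ [] ≡ ys ++ y ∷ x ∷ [] → x ≡ y
++-∷-∷-injective {x = x} {y} xs ys eq =
  sym (∷ʳ-injectiveʳ (xs ++ [ x ]) (ys ++ [ y ])
        (trans (∷ʳ-++ xs x [ y ]) (trans eq (sym (∷ʳ-++ ys y [ x ])))))

∈-++-absorb : ∀ {A : Set} {x : A} {xs ys : List A} → All (_∈ xs) ys → (x ∈ xs ++ ys) ⇔ (x ∈ xs)
∈-++-absorb {xs = xs} ys⊆xs = mk⇔ ([ id , All.lookup ys⊆xs ]′ ∘ ∈-++⁻ xs) ∈-++⁺ˡ

module _ {n : ℕ} where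

  Kept : Fin n → Fin n → Fin n → Set
  Kept c d x = (x ≡ c) ⊎ (x ≡ d)

  kept? : (c d : Fin n) → Decidable (Kept c d)
  kept? c d x = (x ≟ c) ⊎-dec (x ≟ d)

  kept-of-SamePair : ∀ {a b c d} → SamePair c d a b → Kept c d a × Kept c d b
  kept-of-SamePair (inj₁ (refl , refl)) = inj₁ refl , inj₂ refl
  kept-of-SamePair (inj₂ (refl , refl)) = inj₂ refl , inj₁ refl

  SamePair-of-kept : ∀ {a b c d} → a ≢ b → Kept c d a → Kept c d b → SamePair c d a b
  SamePair-of-kept a≢b (inj₁ refl) (inj₁ refl) = ⊥-elim (a≢b refl)
  SamePair-of-kept a≢b (inj₁ refl) (inj₂ refl) = inj₁ (refl , refl)
  SamePair-of-kept a≢b (inj₂ refl) (inj₁ refl) = inj₂ (refl , refl)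
  SamePair-of-kept a≢b (inj₂ refl) (inj₂ refl) = ⊥-elim (a≢b refl)

  unkept-of-¬SamePair : ∀ {a b c d} → a ≢ b → ¬ SamePair c d a b → ¬ Kept c d a ⊎ ¬ Kept c d b
  unkept-of-¬SamePair {a} {b} {c} {d} a≢b ¬same with kept? c d a | kept? c d b
  ... | no ¬ka | _      = inj₁ ¬ka
  ... | yes _  | no ¬kb = inj₂ ¬kb
  ... | yes ka | yes kb = ⊥-elim (¬same (SamePair-of-kept a≢b ka kb))

  proj-++ : ∀ c d (xs ys : Word n) → proj c d (xs ++ ys) ≡ proj c d xs ++ proj c d ys
  proj-++ c d = filter-++ (kept? c d)

  proj-kept-pair : ∀ {c d x y} → Kept c d x → Kept c d y → proj c d (x ∷ y ∷ []) ≡ x ∷ y ∷ []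
  proj-kept-pair {c} {d} kx ky = filter-all (kept? c d) (kx ∷ ky ∷ [])

  proj-swap-unkept : ∀ {c d x y} → ¬ Kept c d x → proj c d (x ∷ y ∷ []) ≡ proj c d (y ∷ x ∷ [])
  proj-swap-unkept {c} {d} {x} {y} ¬kx = begin
    proj c d (x ∷ y ∷ [])             ≡⟨ filter-reject (kept? c d) ¬kx ⟩
    proj c d [ y ]                    ≡⟨ ++-identityʳ _ ⟨
    proj c d [ y ] ++ []              ≡⟨ cong (proj c d [ y ] ++_) (filter-reject (kept? c d) ¬kx) ⟨
    proj c d [ y ] ++ proj c d [ x ]  ≡⟨ proj-++ c d [ y ] [ x ] ⟨
    proj c d (y ∷ x ∷ [])             ∎
    where open ≡-Reasoning

  proj-swap : ∀ {c d x y} → ¬ Kept c d x ⊎ ¬ Kept c d y →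
              proj c d (x ∷ y ∷ []) ≡ proj c d (y ∷ x ∷ [])
  proj-swap (inj₁ ¬kx) = proj-swap-unkept ¬kx
  proj-swap (inj₂ ¬ky) = sym (proj-swap-unkept ¬ky)

  proj-++-swap : ∀ {a b c d} (w v : Word n) → a ≢ b →
                 (proj c d (w ++ a ∷ b ∷ []) ≡ proj c d (v ++ b ∷ a ∷ [])) ⇔
                 (proj c d w ≡ proj c d v × ¬ SamePair c d a b)
  proj-++-swap {a} {b} {c} {d} w v a≢b = mk⇔ split join
    where
    open ≡-Reasoning
    π : Word n → Word n
    π = proj c d

    split : π (w ++ a ∷ b ∷ []) ≡ π (v ++ b ∷ a ∷ []) → π w ≡ π v × ¬ SamePair c d a b
    split eq = ++-cancelʳ (π (b ∷ a ∷ [])) (π w) (π v) (trans (cong (π w ++_) (sym swap)) eq′) , ¬same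
      where
      eq′ : π w ++ π (a ∷ b ∷ []) ≡ π v ++ π (b ∷ a ∷ [])
      eq′ = trans (sym (proj-++ c d w _)) (trans eq (proj-++ c d v _))

      ¬same : ¬ SamePair c d a b
      ¬same same with ka , kb ← kept-of-SamePair same = a≢b (++-∷-∷-injective (π w) (π v) (begin
        π w ++ a ∷ b ∷ []         ≡⟨ cong (π w ++_) (proj-kept-pair ka kb) ⟨
        π w ++ π (a ∷ b ∷ [])     ≡⟨ eq′ ⟩
        π v ++ π (b ∷ a ∷ [])     ≡⟨ cong (π v ++_) (proj-kept-pair kb ka) ⟩
        π v ++ b ∷ a ∷ []         ∎))

      swap : π (a ∷ b ∷ []) ≡ π (b ∷ a ∷ [])
      swap = proj-swap (unkept-of-¬SamePair a≢b ¬same)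

    join : π w ≡ π v × ¬ SamePair c d a b → π (w ++ a ∷ b ∷ []) ≡ π (v ++ b ∷ a ∷ [])
    join (eq , ¬same) = begin
      π (w ++ a ∷ b ∷ [])        ≡⟨ proj-++ c d w _ ⟩
      π w ++ π (a ∷ b ∷ [])      ≡⟨ cong₂ _++_ eq (proj-swap (unkept-of-¬SamePair a≢b ¬same)) ⟩
      π v ++ π (b ∷ a ∷ [])      ≡⟨ proj-++ c d v _ ⟨
      π (v ++ b ∷ a ∷ [])        ∎

  Edge-++-swap : ∀ {a b c d} {w v : Word n} → a ≢ b → a ∈ w → b ∈ w →
                 Edge (w ++ a ∷ b ∷ []) (v ++ b ∷ a ∷ []) c d ⇔ (Edge w v c d × ¬ SamePair c d a b)
  Edge-++-swap {a} {b} {c} {d} {w} {v} a≢b a∈w b∈w = mk⇔ split join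
    where
    absorb : ∀ {x} → (x ∈ w ++ a ∷ b ∷ []) ⇔ (x ∈ w)
    absorb = ∈-++-absorb (a∈w ∷ b∈w ∷ [])

    split : Edge (w ++ a ∷ b ∷ []) (v ++ b ∷ a ∷ []) c d → Edge w v c d × ¬ SamePair c d a b
    split (c≢d , c∈ , d∈ , eq) with eq′ , ¬same ← Equivalence.to (proj-++-swap w v a≢b) eq =
      (c≢d , Equivalence.to absorb c∈ , Equivalence.to absorb d∈ , eq′) , ¬same

    join : Edge w v c d × ¬ SamePair c d a b → Edge (w ++ a ∷ b ∷ []) (v ++ b ∷ a ∷ []) c d
    join ((c≢d , c∈w , d∈w , eq) , ¬same) =
      c≢d , ∈-++⁺ˡ c∈w , ∈-++⁺ˡ d∈w , Equivalence.from (proj-++-swap w v a≢b) (eq , ¬same)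

  SameAlph-++ : ∀ {w v uw uv : Word n} → SameAlph w v → All (_∈ w) uw → All (_∈ v) uv →
                SameAlph (w ++ uw) (v ++ uv)
  SameAlph-++ same uw⊆w uv⊆v c = mk⇔
    (∈-++⁺ˡ ∘ Equivalence.to (same c) ∘ Equivalence.to (∈-++-absorb uw⊆w))
    (∈-++⁺ˡ ∘ Equivalence.from (same c) ∘ Equivalence.to (∈-++-absorb uv⊆v))

  OneUniform-pair : ∀ {a b : Fin n} → a ≢ b → OneUniform (a ∷ b ∷ [])
  OneUniform-pair {a} {b} a≢b .a (here refl) =
    cong length (trans (filter-accept (_≟ a) refl) (cong (a ∷_) (filter-reject (_≟ a) (a≢b ∘ sym))))
  OneUniform-pair {a} {b} a≢b .b (there (here refl)) =
    cong length (trans (filter-reject (_≟ b) a≢b) (filter-accept (_≟ b) refl))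

lemma1 : ∀ (n : ℕ) (w v : Word n) (a b : Fin n) →
    SameAlph w v → Edge w v a b →
    Σ (Word n) λ uw → Σ (Word n) λ uv →
      OneUniform uw × OneUniform uv ×
      SameAlph (w ++ uw) (v ++ uv) ×
      (∀ c d → Edge (w ++ uw) (v ++ uv) c d ⇔ (Edge w v c d × ¬ SamePair c d a b))
lemma1 n w v a b same (a≢b , a∈w , b∈w , _) =
  a ∷ b ∷ [] , b ∷ a ∷ [] ,
  OneUniform-pair a≢b , OneUniform-pair (a≢b ∘ sym) ,
  SameAlph-++ same (a∈w ∷ b∈w ∷ []) (b∈v ∷ a∈v ∷ []) ,
  λ c d → Edge-++-swap {v = v} a≢b a∈w b∈w
  where
  a∈v : a ∈ v
  a∈v = Equivalence.to (same a) a∈w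
  b∈v : b ∈ v
  b∈v = Equivalence.to (same b) b∈w
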